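{- Let $q\ge 2$ and $d\ge 2$ be integers and put $\kappa=(q^d-1)/(q-1)$. Suppose there is a symmetric $2$-$(m,\kappa,\lambda)$ design whose $(m\times m)$ incidence matrix $A$ is symmetric. Let $L=(e(i,j))$ be a symmetric $(m\times m)$ integer matrix obtained from $A$ by replacing, in each row, the $\kappa$ nonzero entries by the integers $1,2,\dots,\kappa$ bijectively (so $e(i,j)=0$ iff $A_{ij}=0$, and for each $i$ the map $j\mapsto e(i,j)$ is a bijection from $\{j: A_{ij}\neq 0\}$ onto $[\kappa]=\{1,\dots,\kappa\}$). Let $\mathcal{D}_1,\dots,\mathcal{D}_m$ be (not necessarily isomorphic) affine designs with parameters $(q,q^{d-2})$, $\mathcal{D}_i=(\mathcal{P}_i,\mathcal{B}_i)$, with pairwise disjoint point sets, each having $\kappa$ parallel classes, which are enumerated by $[\kappa]$; denote the $j$-th parallel class of $\mathcal{D}_i$ by $\mathcal{B}_i^j$, and for $x\in\mathcal{P}_i$ denote by $B_i^j(x)$ the block of $\mathcal{B}_i^j$ containing $x$. For each pair $(i,j)$ with $e(i,j)\neq 0$, choose a bijection $\sigma_{i,j}:\mathcal{B}_i^{e(i,j)}\to\mathcal{B}_j^{e(j,i)}$ such that $\sigma_{i,j}=\sigma_{j,i}^{ -1}$ for $i\neq j$ and $\sigma_{i,i}$ is the identity map on $\mathcal{B}_i^{e(i,i)}$. Let $\Gamma$ be the graph with vertex set $\bigcup_{i=1}^m\mathcal{P}_i$, in which two different vertices $x\in\mathcal{P}_i$ and $y\in\mathcal{P}_j$ are adjacent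 if and only if $e(i,j)\neq 0$ and $y\notin\sigma_{i,j}\big(B_i^{e(i,j)}(x)\big)$. Then $\Gamma$ is a divisible design graph with parameters $$v=q^d m,\quad k=q^{d-1}(q^d-1),\quad \lambda_1=q^{d-1}(q^d-q^{d-1}-1),\quad \lambda_2=q^{d-2}(q-1)^2\lambda,\quad m,\quad n=q^d.$$
   Context: A $k$-regular graph on $v$ vertices is a divisible design graph with parameters $(v,k,\lambda_1,\lambda_2,m,n)$ if its vertex set can be partitioned into $m$ classes of size $n$ such that any two different vertices in the same class have exactly $\lambda_1$ common neighbours and any two vertices in different classes have exactly $\lambda_2$ common neighbours. A symmetric $2$-$(m,\kappa,\lambda)$ design has $m$ points and $m$ blocks, each block of size $\kappa$, any two distinct points lying in exactly $\lambda$ common blocks. An affine design with parameters $(q,r)$ is a $2$-design in which any two blocks are either disjoint or meet in exactly $r$ points, and each block together with all blocks disjoint from it forms a parallel class: a set of $q$ mutually disjoint blocks partitioning the point set. An affine design with parameters $(q,q^{d-2})$ has $q^d$ points, blocks of size $q^{d-1}$, $(q^d-1)/(q-1)$ parallel classes, and any two distinct points lie in exactly $(q^{d-1}-1)/(q-1)$ common blocks (e.g. the points and hyperplanes of the $d$-dimensional affine space over $\mathbb{F}_q$). -}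

module Defs where

open import Data.Nat using (ℕ; zero; suc; _+_; _*_; _∸_; _^_; _≤_; _≡ᵇ_)
open import Data.Bool using (Bool; true; false; not; _∧_; _∨_; if_then_else_)
open import Data.Fin using (Fin) renaming (_≟_ to _≟ᶠ_)
import Data.Fin as F
open import Data.List using (List; []; _∷_; length)
open import Data.List.Membership.Propositional using (_∈_)
open import Data.List.Relation.Unary.Unique.Propositional using (Unique)
open import Data.Product using (Σ; _×_; _,_; ∃; ∃-syntax)
open import Data.Product.Properties using (≡-dec)
open import Data.Sum using (_⊎_)
open import Relation.Nullary using (¬_; does)
open import Relation.Binary.PropositionalEquality using (_≡_; _≢_)

count : ∀ {n} → (Fin n → Bool) → ℕ
count {zero}  f = 0
count {suc n} f = (if f F.zero then 1 else 0) + count (λ i → f (F.suc i))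

anyFin : ∀ {n} → (Fin n → Bool) → Bool
anyFin {zero}  f = false
anyFin {suc n} f = f F.zero ∨ anyFin (λ i → f (F.suc i))

countL : ∀ {V : Set} → List V → (V → Bool) → ℕ
countL []       f = 0
countL (x ∷ xs) f = (if f x then 1 else 0) + countL xs f

IsEnumeration : {V : Set} → List V → Set
IsEnumeration {V} xs = Unique xs × (∀ (x : V) → x ∈ xs)

IsSimpleGraph : {V : Set} → (V → V → Bool) → Set
IsSimpleGraph {V} adj = (∀ (x y : V) → adj x y ≡ adj y x) × (∀ (x : V) → adj x x ≡ false)

commonNbrs : {V : Set} → List V → (V → V → Bool) → V → V → ℕ
commonNbrs xs adj x y = countL xs (λ z → adj x z ∧ adj y z)

DDGConditions : {V : Set} → List V → (V → V → Bool) → (v k λ₁ λ₂ m n : ℕ) → Set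
DDGConditions {V} xs adj v k λ₁ λ₂ m n =
  length xs ≡ v
  × (∀ (x : V) → countL xs (adj x) ≡ k)
  × Σ (V → Fin m) λ cls →
      (∀ (c : Fin m) → countL xs (λ z → does (cls z ≟ᶠ c)) ≡ n)
      × (∀ (x y : V) → x ≢ y → cls x ≡ cls y → commonNbrs xs adj x y ≡ λ₁)
      × (∀ (x y : V) → cls x ≢ cls y → commonNbrs xs adj x y ≡ λ₂)

-- The graph (V, adj) is a divisible design graph with parameters
-- (v,k,λ₁,λ₂,m,n): V is finite, adj is a simple graph, and the counting
-- conditions hold (they do not depend on the chosen enumeration).
IsDDG : (V : Set) → (V → V → Bool) → (v k λ₁ λ₂ m n : ℕ) → Set
IsDDG V adj v k λ₁ λ₂ m n =
  (Σ (List V) IsEnumeration)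
  × IsSimpleGraph adj
  × (∀ (xs : List V) → IsEnumeration xs → DDGConditions xs adj v k λ₁ λ₂ m n)

-- Symmetric 2-(m,κ,λ) design given by an m×m incidence matrix
-- (A i j ≡ true iff point i lies on block j).

IsSymmetricDesign : (m κ lam : ℕ) → (Fin m → Fin m → Bool) → Set
IsSymmetricDesign m κ lam A =
  (∀ (j : Fin m) → count (λ i → A i j) ≡ κ)
  × (∀ (i i' : Fin m) → i ≢ i' → count (λ j → A i j ∧ A i' j) ≡ lam)

IsSymmetricMatrix : {m : ℕ} → {X : Set} → (Fin m → Fin m → X) → Set
IsSymmetricMatrix {m} M = ∀ (i j : Fin m) → M i j ≡ M j i

IsLabelling : {m : ℕ} → (κ : ℕ) → (Fin m → Fin m → Bool) → (Fin m → Fin m → ℕ) → Set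
IsLabelling {m} κ A e =
  (∀ (i j : Fin m) → (e i j ≡ 0 → A i j ≡ false) × (A i j ≡ false → e i j ≡ 0))
  × (∀ (i j : Fin m) → A i j ≡ true → 1 ≤ e i j × e i j ≤ κ)
  × (∀ (i j j' : Fin m) → A i j ≡ true → A i j' ≡ true → e i j ≡ e i j' → j ≡ j')
  × (∀ (i : Fin m) (c : ℕ) → 1 ≤ c → c ≤ κ → ∃[ j ] (A i j ≡ true × e i j ≡ c))

record AffineDesign (q r : ℕ) : Set where
  field
    npts    : ℕ
    nblocks : ℕ
    inc     : Fin npts → Fin nblocks → Bool

  meet : Fin nblocks → Fin nblocks → ℕ
  meet B B' = count (λ x → inc x B ∧ inc x B')

  inClassOf : Fin nblocks → Fin nblocks → Bool
  inClassOf B B' = does (B' ≟ᶠ B) ∨ (meet B B' ≡ᵇ 0)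

  field
    blockSize   : ℕ
    pairIndex   : ℕ
    isBlockReg  : ∀ (B : Fin nblocks) → count (λ x → inc x B) ≡ blockSize
    is2design   : ∀ (x y : Fin npts) → x ≢ y → count (λ B → inc x B ∧ inc y B) ≡ pairIndex
    intersections : ∀ (B B' : Fin nblocks) → B ≢ B' → meet B B' ≡ 0 ⊎ meet B B' ≡ r
    -- each block together with the blocks disjoint from it is a parallel
    -- class: q mutually disjoint blocks partitioning the point set
    classSize     : ∀ (B : Fin nblocks) → count (inClassOf B) ≡ q
    classDisjoint : ∀ (B B₁ B₂ : Fin nblocks) → inClassOf B B₁ ≡ true → inClassOf B B₂ ≡ true
                    → B₁ ≢ B₂ → meet B₁ B₂ ≡ 0
    classCovers   : ∀ (B : Fin nblocks) (x : Fin npts) → ∃[ B' ] (inClassOf B B' ≡ true × inc x B' ≡ true)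

-- An enumeration of the parallel classes of D by [κ] = {1,…,κ}:
-- label B is the number of the parallel class containing B.
IsClassEnumeration : {q r : ℕ} → (κ : ℕ) → (D : AffineDesign q r) → (Fin (AffineDesign.nblocks D) → ℕ) → Set
IsClassEnumeration κ D label =
  (∀ B → 1 ≤ label B × label B ≤ κ)
  × (∀ (c : ℕ) → 1 ≤ c → c ≤ κ → ∃[ B ] (label B ≡ c))
  × (∀ B B' → (label B ≡ label B' → AffineDesign.inClassOf D B B' ≡ true)
              × (AffineDesign.inClassOf D B B' ≡ true → label B ≡ label B'))

module Construction {q r m : ℕ}
  (e     : Fin m → Fin m → ℕ)
  (D     : Fin m → AffineDesign q r)
  (label : (i : Fin m) → Fin (AffineDesign.nblocks (D i)) → ℕ)
  (σ     : (i j : Fin m) → Fin (AffineDesign.nblocks (D i)) → Fin (AffineDesign.nblocks (D j)))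
  where

  open AffineDesign

  IsGluing : Set
  IsGluing =
    (∀ i j → e i j ≢ 0 → ∀ B → label i B ≡ e i j → label j (σ i j B) ≡ e j i)
    × (∀ i j → e i j ≢ 0 → ∀ B B' → label i B ≡ e i j → label i B' ≡ e i j
         → σ i j B ≡ σ i j B' → B ≡ B')
    × (∀ i j → e i j ≢ 0 → ∀ B' → label j B' ≡ e j i
         → ∃[ B ] (label i B ≡ e i j × σ i j B ≡ B'))
    × (∀ i j → e i j ≢ 0 → i ≢ j → ∀ B → label i B ≡ e i j → σ j i (σ i j B) ≡ B)
    × (∀ i → e i i ≢ 0 → ∀ B → label i B ≡ e i i → σ i i B ≡ B)

  Vertex : Set
  Vertex = Σ (Fin m) (λ i → Fin (npts (D i)))

  _≟ᵥ_ : (u w : Vertex) → _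
  _≟ᵥ_ = ≡-dec _≟ᶠ_ _≟ᶠ_

  -- y ∈ σ_{i,j}(B_i^{e(i,j)}(x)) : some block of class e(i,j) of D_i
  -- through x (there is exactly one) is mapped by σ_{i,j} onto a block
  -- containing y
  inImage : (i j : Fin m) → Fin (npts (D i)) → Fin (npts (D j)) → Bool
  inImage i j x y =
    anyFin (λ B → (label i B ≡ᵇ e i j) ∧ inc (D i) x B ∧ inc (D j) y (σ i j B))

  adj : Vertex → Vertex → Bool
  adj (i , x) (j , y) =
    not (does ((i , x) ≟ᵥ (j , y))) ∧ not (e i j ≡ᵇ 0) ∧ not (inImage i j x y)

{-# OPTIONS --safe #-}

-- For x ∈ P_i and h with A i h = 1, the neighbours of x in P_h are exactly the points off the
-- block σ_{i,h}(B_i^{e(i,h)}(x)) of D_h; when A i h = 0 there are none. So every count is a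
-- count of points off one or two blocks of some D_h. Summing q^d − q^{d−1} over the κ values
-- of h gives the degree. For y ∈ P_j with j ≠ i, the blocks attached to x and y lie in the
-- parallel classes e(h,i) ≠ e(h,j) of D_h, so they meet in q^{d−2} points, and each of the
-- λ common neighbours h of i and j contributes q^{d−2}(q−1)². For y ∈ P_i, y ≠ x, the two
-- blocks coincide or are disjoint according as x and y share the block of class e(i,h) of
-- D_i; as h ↦ e(i,h) enumerates the parallel classes of D_i, this happens for exactly μ
-- values of h, μ being the pair index of D_i. The parameters of D_i (q^d points, blocks of
-- size q^{d−1}, (q − 1)μ = q^{d−1} − 1) follow from its parallel classes by double counting.

module Submission where

open import Defs
open import Function using (_∘_)
open import Function.Bundles using (mk⇔)
open import Algebra.Bundles using (CommutativeMonoid)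
open import Data.Nat using (ℕ; zero; suc; _+_; _*_; _∸_; _^_; _≤_; _<_; _≡ᵇ_; z≤n; s≤s; NonZero; >-nonZero; >-nonZero⁻¹)
open import Data.Nat.Properties
open import Data.Nat.Tactic.RingSolver using (solve-∀)
open import Algebra.Properties.Semiring.Sum +-*-semiring using (sum; sum-syntax; ∑-comm; ∑-distrib-+; sum-cong-≗; sum-remove; *-distribˡ-sum)
open import Algebra.Properties.CommutativeSemigroup +-commutativeSemigroup using () renaming (x∙yz≈y∙xz to +-exchange)
open import Data.Bool using (Bool; true; false; not; _∧_; _∨_; if_then_else_; T)
open import Data.Bool.Properties using (∧-comm; ∧-idem; ∧-identityʳ; ∧-zeroʳ; ∧-conicalˡ; ∧-conicalʳ; ∨-zeroʳ; ∨-identityʳ; ⇔→≡; ∧-commutativeMonoid)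
open import Algebra.Properties.CommutativeSemigroup (CommutativeMonoid.commutativeSemigroup ∧-commutativeMonoid) using () renaming (x∙yz≈y∙xz to ∧-exchange)
open import Data.Fin using (Fin; zero; suc; toℕ; fromℕ<; punchIn) renaming (_≟_ to _≟ᶠ_)
open import Data.Fin.Properties using (punchInᵢ≢i; toℕ-injective; toℕ<n; toℕ-fromℕ<) renaming (suc-injective to suc-injectiveᶠ)
open import Data.List using (List; []; _∷_; _++_; map; tabulate; length)
open import Data.List.Membership.Propositional using (_∈_)
open import Data.List.Membership.Propositional.Properties using (∈-++⁺ˡ; ∈-++⁺ʳ; ∈-map⁺; ∈-map⁻; ∈-tabulate⁺; ∈-tabulate⁻)
open import Data.List.Membership.Propositional.Properties.WithK using (unique∧set⇒bag)
open import Data.List.Relation.Binary.BagAndSetEquality using (∼bag⇒↭)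
open import Data.List.Relation.Binary.Permutation.Propositional as Perm using (_↭_)
open import Data.List.Relation.Unary.AllPairs using ([])
open import Data.List.Relation.Unary.Unique.Propositional.Properties using (++⁺; map⁺; tabulate⁺)
open import Data.Product using (Σ; Σ-syntax; ∃-syntax; _×_; _,_; proj₁; proj₂)
open import Data.Sum using (inj₁; inj₂)
open import Data.Empty using (⊥; ⊥-elim)
open import Relation.Nullary using (does; yes; no; contradiction)
open import Relation.Nullary.Decidable using (dec-true; dec-false)
open import Relation.Binary.PropositionalEquality using (_≡_; _≢_; refl; sym; trans; cong; cong₂; subst)
open Relation.Binary.PropositionalEquality.≡-Reasoning

≡ᵇ-true⇒≡ : ∀ {m n} → (m ≡ᵇ n) ≡ true → m ≡ n
≡ᵇ-true⇒≡ {m} {n} eq = ≡ᵇ⇒≡ m n (subst T (sym eq) _)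

≡⇒≡ᵇ-true : ∀ {m n} → m ≡ n → (m ≡ᵇ n) ≡ true
≡⇒≡ᵇ-true {m} {n} = dec-true (m ≟ n)

≢⇒≡ᵇ-false : ∀ {m n} → m ≢ n → (m ≡ᵇ n) ≡ false
≢⇒≡ᵇ-false {m} {n} = dec-false (m ≟ n)

indicator : Bool → ℕ
indicator b = if b then 1 else 0

count≡∑ : ∀ {n} (f : Fin n → Bool) → count f ≡ ∑[ i < n ] indicator (f i)
count≡∑ {zero}  f = refl
count≡∑ {suc n} f = cong (indicator (f zero) +_) (count≡∑ (f ∘ suc))

count-cong : ∀ {n} {f g : Fin n → Bool} → (∀ i → f i ≡ g i) → count f ≡ count g
count-cong {zero}  f≗g = refl
count-cong {suc n} f≗g = cong₂ _+_ (cong indicator (f≗g zero)) (count-cong (f≗g ∘ suc))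

count-const-true : ∀ n → count {n} (λ _ → true) ≡ n
count-const-true zero    = refl
count-const-true (suc n) = cong suc (count-const-true n)

count-none : ∀ {n} (f : Fin n → Bool) → (∀ i → f i ≡ false) → count f ≡ 0
count-none {zero}  f none = refl
count-none {suc n} f none rewrite none zero = count-none (f ∘ suc) (none ∘ suc)

∑-const : ∀ n c → ∑[ i < n ] c ≡ n * c
∑-const zero    c = refl
∑-const (suc n) c = cong (c +_) (∑-const n c)

∑-guarded : ∀ {n} (b : Fin n → Bool) (g : Fin n → ℕ) c → (∀ i → g i ≡ (if b i then c else 0)) →
            ∑[ i < n ] g i ≡ count b * c
∑-guarded {zero}  b g c g≗ = refl
∑-guarded {suc n} b g c g≗ rewrite g≗ zero | ∑-guarded (b ∘ suc) (g ∘ suc) c (g≗ ∘ suc) with b zero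
... | true  = refl
... | false = refl

∑-except : ∀ {n} (g : Fin n → ℕ) j c → (∀ i → i ≢ j → g i ≡ c) → ∑[ i < n ] g i ≡ g j + (n ∸ 1) * c
∑-except {suc n} g j c others = begin
  sum g                     ≡⟨ sum-remove {i = j} g ⟩
  g j + sum (g ∘ punchIn j) ≡⟨ cong (g j +_) (sum-cong-≗ (λ i → others (punchIn j i) (punchInᵢ≢i j i))) ⟩
  g j + ∑[ i < n ] c        ≡⟨ cong (g j +_) (∑-const n c) ⟩
  g j + n * c               ∎

∑-single : ∀ {n} (g : Fin n → ℕ) j → (∀ i → i ≢ j → g i ≡ 0) → ∑[ i < n ] g i ≡ g j
∑-single {n} g j others = begin
  ∑[ i < n ] g i        ≡⟨ ∑-except g j 0 others ⟩
  g j + (n ∸ 1) * 0     ≡⟨ cong (g j +_) (*-zeroʳ (n ∸ 1)) ⟩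
  g j + 0               ≡⟨ +-identityʳ (g j) ⟩
  g j                   ∎

count-unique : ∀ {n} (f : Fin n → Bool) j → f j ≡ true → (∀ i → f i ≡ true → i ≡ j) → count f ≡ 1
count-unique f j fj unique = begin
  count f                   ≡⟨ count≡∑ f ⟩
  sum (indicator ∘ f)       ≡⟨ ∑-single (indicator ∘ f) j others ⟩
  indicator (f j)           ≡⟨ cong indicator fj ⟩
  1                         ∎
  where
  others : ∀ i → i ≢ j → indicator (f i) ≡ 0
  others i i≢j with f i in fi
  ... | true  = ⊥-elim (i≢j (unique i fi))
  ... | false = refl

count≢0 : ∀ {n} (f : Fin n → Bool) j → f j ≡ true → count f ≢ 0
count≢0 {suc n} f j fj count≡0 = 0≢1+n (begin
  0                                              ≡⟨ count≡0 ⟨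
  count f                                        ≡⟨ count≡∑ f ⟩
  sum (indicator ∘ f)                            ≡⟨ sum-remove {i = j} (indicator ∘ f) ⟩
  indicator (f j) + sum (indicator ∘ f ∘ punchIn j) ≡⟨ cong (λ b → indicator b + sum (indicator ∘ f ∘ punchIn j)) fj ⟩
  suc (sum (indicator ∘ f ∘ punchIn j))          ∎)

count-not : ∀ {n} (f : Fin n → Bool) → count (not ∘ f) + count f ≡ n
count-not {zero}  f = refl
count-not {suc n} f with f zero
... | true  = trans (+-suc _ _) (cong suc (count-not (f ∘ suc)))
... | false = cong suc (count-not (f ∘ suc))

count-neither : ∀ {n} (f g : Fin n → Bool) →
                count (λ i → not (f i) ∧ not (g i)) + count f + count g ≡ n + count (λ i → f i ∧ g i)
count-neither {n} f g = begin
  count neither + count f + count g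
    ≡⟨ cong₂ _+_ (cong₂ _+_ (count≡∑ neither) (count≡∑ f)) (count≡∑ g) ⟩
  ∑[ i < n ] indicator (neither i) + ∑[ i < n ] indicator (f i) + ∑[ i < n ] indicator (g i)
    ≡⟨ cong (_+ _) (∑-distrib-+ (indicator ∘ neither) (indicator ∘ f)) ⟨
  ∑[ i < n ] (indicator (neither i) + indicator (f i)) + ∑[ i < n ] indicator (g i)
    ≡⟨ ∑-distrib-+ _ (indicator ∘ g) ⟨
  ∑[ i < n ] (indicator (neither i) + indicator (f i) + indicator (g i))
    ≡⟨ sum-cong-≗ (λ i → pointwise (f i) (g i)) ⟩
  ∑[ i < n ] (1 + indicator (f i ∧ g i))
    ≡⟨ ∑-distrib-+ {n} (λ _ → 1) _ ⟩
  ∑[ i < n ] 1 + ∑[ i < n ] indicator (f i ∧ g i)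
    ≡⟨ cong₂ _+_ (trans (∑-const n 1) (*-identityʳ n)) (sym (count≡∑ (λ i → f i ∧ g i))) ⟩
  n + count (λ i → f i ∧ g i) ∎
  where
  neither : Fin n → Bool
  neither i = not (f i) ∧ not (g i)
  pointwise : ∀ a b → indicator (not a ∧ not b) + indicator a + indicator b ≡ 1 + indicator (a ∧ b)
  pointwise true  true  = refl
  pointwise true  false = refl
  pointwise false true  = refl
  pointwise false false = refl

count-others : ∀ {n} (f : Fin n → Bool) j → f j ≡ true → count (λ i → not (does (i ≟ᶠ j)) ∧ f i) ≡ count f ∸ 1
count-others {suc n} f j fj = begin
  count others
    ≡⟨ count≡∑ others ⟩
  sum (indicator ∘ others)
    ≡⟨ sum-remove {i = j} (indicator ∘ others) ⟩
  indicator (others j) + sum (indicator ∘ others ∘ punchIn j)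
    ≡⟨ cong₂ _+_ at-j (sum-cong-≗ away-from-j) ⟩
  sum (indicator ∘ f ∘ punchIn j)
    ≡⟨ cong (λ b → indicator b + sum (indicator ∘ f ∘ punchIn j) ∸ 1) fj ⟨
  indicator (f j) + sum (indicator ∘ f ∘ punchIn j) ∸ 1
    ≡⟨ cong (_∸ 1) (trans (count≡∑ f) (sum-remove {i = j} (indicator ∘ f))) ⟨
  count f ∸ 1 ∎
  where
  others : Fin (suc n) → Bool
  others i = not (does (i ≟ᶠ j)) ∧ f i
  at-j : indicator (others j) ≡ 0
  at-j rewrite dec-true (j ≟ᶠ j) refl = refl
  away-from-j : ∀ i → indicator (others (punchIn j i)) ≡ indicator (f (punchIn j i))
  away-from-j i rewrite dec-false (punchIn j i ≟ᶠ j) (punchInᵢ≢i j i) = refl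

anyFin-none : ∀ {n} (f : Fin n → Bool) → (∀ i → f i ≡ false) → anyFin f ≡ false
anyFin-none {zero}  f none = refl
anyFin-none {suc n} f none rewrite none zero = anyFin-none (f ∘ suc) (none ∘ suc)

anyFin-unique : ∀ {n} (f : Fin n → Bool) j → (∀ i → i ≢ j → f i ≡ false) → anyFin f ≡ f j
anyFin-unique {suc n} f zero others rewrite anyFin-none (f ∘ suc) (λ i → others (suc i) λ ()) = ∨-identityʳ (f zero)
anyFin-unique {suc n} f (suc j) others rewrite others zero (λ ()) =
  anyFin-unique (f ∘ suc) j (λ i i≢j → others (suc i) (i≢j ∘ suc-injectiveᶠ))

count-swap : ∀ {n k} (R : Fin n → Fin k → Bool) →
             ∑[ i < n ] count (R i) ≡ ∑[ j < k ] count (λ i → R i j)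
count-swap {n} {k} R = begin
  ∑[ i < n ] count (R i)                        ≡⟨ sum-cong-≗ (count≡∑ ∘ R) ⟩
  ∑[ i < n ] ∑[ j < k ] indicator (R i j)       ≡⟨ ∑-comm (λ i j → indicator (R i j)) ⟩
  ∑[ j < k ] ∑[ i < n ] indicator (R i j)       ≡⟨ sum-cong-≗ (λ j → count≡∑ (λ i → R i j)) ⟨
  ∑[ j < k ] count (λ i → R i j)                ∎

∑-count-guarded : ∀ {n k} (b : Fin n → Bool) (R : Fin n → Fin k → Bool) {c} →
                  (∀ i → b i ≡ true → count (R i) ≡ c) → ∑[ i < n ] count (λ j → b i ∧ R i j) ≡ count b * c
∑-count-guarded {n} {k} b R {c} hyp = ∑-guarded b _ c pointwise
  where
  pointwise : ∀ i → count (λ j → b i ∧ R i j) ≡ (if b i then c else 0)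
  pointwise i with b i in bi
  ... | true  = hyp i bi
  ... | false = count-none {k} _ (λ _ → refl)

double-count : ∀ {n k} (b : Fin n → Bool) (b′ : Fin k → Bool) (R : Fin n → Fin k → Bool) {c c′} →
               (∀ i → b i ≡ true → count (λ j → b′ j ∧ R i j) ≡ c) →
               (∀ j → b′ j ≡ true → count (λ i → b i ∧ R i j) ≡ c′) →
               count b * c ≡ count b′ * c′
double-count {n} {k} b b′ R {c} {c′} hyp hyp′ = begin
  count b * c                                   ≡⟨ ∑-count-guarded b (λ i j → b′ j ∧ R i j) hyp ⟨
  ∑[ i < n ] count (λ j → b i ∧ (b′ j ∧ R i j)) ≡⟨ count-swap (λ i j → b i ∧ (b′ j ∧ R i j)) ⟩
  ∑[ j < k ] count (λ i → b i ∧ (b′ j ∧ R i j)) ≡⟨ sum-cong-≗ (λ j → count-cong (λ i → ∧-exchange (b i) (b′ j) (R i j))) ⟩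
  ∑[ j < k ] count (λ i → b′ j ∧ (b i ∧ R i j)) ≡⟨ ∑-count-guarded b′ (λ j i → b i ∧ R i j) hyp′ ⟩
  count b′ * c′                                 ∎

DisjointUnion : ∀ {m} → (Fin m → ℕ) → Set
DisjointUnion {m} P = Σ (Fin m) (λ i → Fin (P i))

countL-↭ : ∀ {V : Set} {xs ys : List V} (f : V → Bool) → xs ↭ ys → countL xs f ≡ countL ys f
countL-↭ f Perm.refl             = refl
countL-↭ f (Perm.prep x xs↭ys)   = cong (indicator (f x) +_) (countL-↭ f xs↭ys)
countL-↭ f (Perm.swap x y xs↭ys) = trans (cong (λ c → indicator (f x) + (indicator (f y) + c)) (countL-↭ f xs↭ys))
                                          (+-exchange (indicator (f x)) (indicator (f y)) _)
countL-↭ f (Perm.trans xs↭ys ys↭zs) = trans (countL-↭ f xs↭ys) (countL-↭ f ys↭zs)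

enumerations-↭ : ∀ {V : Set} {xs ys : List V} → IsEnumeration xs → IsEnumeration ys → xs ↭ ys
enumerations-↭ (xs-unique , xs-covers) (ys-unique , ys-covers) =
  ∼bag⇒↭ (unique∧set⇒bag xs-unique ys-unique (mk⇔ (λ _ → ys-covers _) (λ _ → xs-covers _)))

countL-++ : ∀ {V : Set} (xs ys : List V) (f : V → Bool) → countL (xs ++ ys) f ≡ countL xs f + countL ys f
countL-++ []       ys f = refl
countL-++ (x ∷ xs) ys f = trans (cong (indicator (f x) +_) (countL-++ xs ys f)) (sym (+-assoc (indicator (f x)) _ _))

countL-map : ∀ {U V : Set} (g : U → V) (xs : List U) (f : V → Bool) → countL (map g xs) f ≡ countL xs (f ∘ g)
countL-map g []       f = refl
countL-map g (x ∷ xs) f = cong (indicator (f (g x)) +_) (countL-map g xs f)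

countL-tabulate : ∀ {V : Set} {n} (g : Fin n → V) (f : V → Bool) → countL (tabulate g) f ≡ count (f ∘ g)
countL-tabulate {n = zero}  g f = refl
countL-tabulate {n = suc n} g f = cong (indicator (f (g zero)) +_) (countL-tabulate (g ∘ suc) f)

suc-fibre : ∀ {m} {P : Fin (suc m) → ℕ} → DisjointUnion (P ∘ suc) → DisjointUnion P
suc-fibre (i , x) = suc i , x

canonicalEnumeration : ∀ m (P : Fin m → ℕ) → List (DisjointUnion P)
canonicalEnumeration zero    P = []
canonicalEnumeration (suc m) P = tabulate (λ x → zero , x) ++ map suc-fibre (canonicalEnumeration m (P ∘ suc))

canonicalEnumeration-isEnumeration : ∀ m (P : Fin m → ℕ) → IsEnumeration (canonicalEnumeration m P)
canonicalEnumeration-isEnumeration zero    P = [] , λ ()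
canonicalEnumeration-isEnumeration (suc m) P =
  ++⁺ (tabulate⁺ zero-injective) (map⁺ suc-fibre-injective unique) disjoint , covers
  where
  open Σ (canonicalEnumeration-isEnumeration m (P ∘ suc)) renaming (proj₁ to unique; proj₂ to covers′)
  zero-injective : ∀ {x y : Fin (P zero)} → _≡_ {A = DisjointUnion P} (zero , x) (zero , y) → x ≡ y
  zero-injective refl = refl
  suc-fibre-injective : ∀ {u w : DisjointUnion (P ∘ suc)} → suc-fibre {P = P} u ≡ suc-fibre w → u ≡ w
  suc-fibre-injective {_ , _} {_ , _} refl = refl
  disjoint : ∀ {u} → u ∈ tabulate (λ x → zero , x) × u ∈ map suc-fibre (canonicalEnumeration m (P ∘ suc)) → ⊥
  disjoint (u∈₀ , u∈₊) with ∈-tabulate⁻ {f = λ x → zero , x} u∈₀ | ∈-map⁻ suc-fibre u∈₊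
  ... | _ , refl | (_ , _) , _ , ()
  covers : (u : DisjointUnion P) → u ∈ canonicalEnumeration (suc m) P
  covers (zero  , x) = ∈-++⁺ˡ (∈-tabulate⁺ x)
  covers (suc i , x) = ∈-++⁺ʳ (tabulate (λ x → zero , x)) (∈-map⁺ suc-fibre (covers′ (i , x)))

countL-canonicalEnumeration : ∀ m (P : Fin m → ℕ) (f : DisjointUnion P → Bool) →
                              countL (canonicalEnumeration m P) f ≡ ∑[ i < m ] count (λ x → f (i , x))
countL-canonicalEnumeration zero    P f = refl
countL-canonicalEnumeration (suc m) P f = begin
  countL (tabulate (λ x → zero , x) ++ map suc-fibre (canonicalEnumeration m (P ∘ suc))) f
    ≡⟨ countL-++ (tabulate (λ x → zero , x)) _ f ⟩
  countL (tabulate (λ x → zero , x)) f + countL (map suc-fibre (canonicalEnumeration m (P ∘ suc))) f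
    ≡⟨ cong₂ _+_ (countL-tabulate (λ x → zero , x) f) (countL-map suc-fibre (canonicalEnumeration m (P ∘ suc)) f) ⟩
  count (λ x → f (zero , x)) + countL (canonicalEnumeration m (P ∘ suc)) (f ∘ suc-fibre)
    ≡⟨ cong (count (λ x → f (zero , x)) +_) (countL-canonicalEnumeration m (P ∘ suc) (f ∘ suc-fibre)) ⟩
  count (λ x → f (zero , x)) + ∑[ i < m ] count (λ x → f (suc i , x)) ∎

countL-enumeration : ∀ {m} (P : Fin m → ℕ) {xs : List (DisjointUnion P)} → IsEnumeration xs →
                     (f : DisjointUnion P → Bool) → countL xs f ≡ ∑[ i < m ] count (λ x → f (i , x))
countL-enumeration {m} P enum f =
  trans (countL-↭ f (enumerations-↭ enum (canonicalEnumeration-isEnumeration m P)))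
        (countL-canonicalEnumeration m P f)

length≡countL : ∀ {V : Set} (xs : List V) → length xs ≡ countL xs (λ _ → true)
length≡countL []       = refl
length≡countL (x ∷ xs) = cong suc (length≡countL xs)

module _ {q r : ℕ} (D : AffineDesign q r) where
  open AffineDesign D

  pairIndex-replication : ∀ x → (npts ∸ 1) * pairIndex ≡ count (λ B → inc x B) * (blockSize ∸ 1)
  pairIndex-replication x = begin
    (npts ∸ 1) * pairIndex          ≡⟨ cong (_* pairIndex) other-points ⟨
    count other * pairIndex         ≡⟨ double-count other (λ B → inc x B) (λ y B → inc y B) pairs block-rest ⟩
    count (λ B → inc x B) * (blockSize ∸ 1) ∎
    where
    other : Fin npts → Bool
    other y = not (does (y ≟ᶠ x))
    other-points : count other ≡ npts ∸ 1
    other-points = begin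
      count other                                     ≡⟨ count-cong (λ y → ∧-identityʳ (other y)) ⟨
      count (λ y → other y ∧ true)                    ≡⟨ count-others (λ _ → true) x refl ⟩
      count {npts} (λ _ → true) ∸ 1                   ≡⟨ cong (_∸ 1) (count-const-true npts) ⟩
      npts ∸ 1                                        ∎
    pairs : ∀ y → other y ≡ true → count (λ B → inc x B ∧ inc y B) ≡ pairIndex
    pairs y y≠x with y ≟ᶠ x
    pairs y () | yes _
    pairs y _  | no y≢x = is2design x y (y≢x ∘ sym)
    block-rest : ∀ B → inc x B ≡ true → count (λ y → other y ∧ inc y B) ≡ blockSize ∸ 1
    block-rest B x∈B = trans (count-others (λ y → inc y B) x x∈B) (cong (_∸ 1) (isBlockReg B))

module ParallelClasses {q r κ : ℕ} (D : AffineDesign q r) {label : Fin (AffineDesign.nblocks D) → ℕ}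
                       (classes : IsClassEnumeration κ D label) where
  open AffineDesign D

  labelled : ∀ B → 1 ≤ label B × label B ≤ κ
  labelled = proj₁ classes

  some-block-labelled : ∀ c → 1 ≤ c → c ≤ κ → ∃[ B ] label B ≡ c
  some-block-labelled = proj₁ (proj₂ classes)

  same-label⇒same-class : ∀ B B′ → label B ≡ label B′ → inClassOf B B′ ≡ true
  same-label⇒same-class B B′ = proj₁ (proj₂ (proj₂ classes) B B′)

  same-class⇒same-label : ∀ B B′ → inClassOf B B′ ≡ true → label B ≡ label B′
  same-class⇒same-label B B′ = proj₂ (proj₂ (proj₂ classes) B B′)

  inClassOf-refl : ∀ B → inClassOf B B ≡ true
  inClassOf-refl B rewrite dec-true (B ≟ᶠ B) refl = refl

  same-label-disjoint : ∀ {B B′} → label B ≡ label B′ → B ≢ B′ → meet B B′ ≡ 0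
  same-label-disjoint {B} {B′} same B≢B′ =
    classDisjoint B B B′ (inClassOf-refl B) (same-label⇒same-class B B′ same) B≢B′

  different-labels-meet : ∀ {B B′} → label B ≢ label B′ → meet B B′ ≡ r
  different-labels-meet {B} {B′} different with intersections B B′ (different ∘ cong label)
  ... | inj₂ meet≡r = meet≡r
  ... | inj₁ meet≡0 = contradiction (same-class⇒same-label B B′ disjoint⇒same-class) different
    where
    disjoint⇒same-class : inClassOf B B′ ≡ true
    disjoint⇒same-class rewrite meet≡0 = ∨-zeroʳ (does (B′ ≟ᶠ B))

  block-through : ∀ x {c} → 1 ≤ c → c ≤ κ → Σ[ B ∈ Fin nblocks ] label B ≡ c × inc x B ≡ true
  block-through x 1≤c c≤κ with some-block-labelled _ 1≤c c≤κ
  ... | B₀ , B₀-labelled with classCovers B₀ x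
  ...   | B , B₀∼B , x∈B = B , trans (sym (same-class⇒same-label B₀ B B₀∼B)) B₀-labelled , x∈B

  block-through-unique : ∀ {x B B′} → label B ≡ label B′ → inc x B ≡ true → inc x B′ ≡ true → B ≡ B′
  block-through-unique {x} {B} {B′} same x∈B x∈B′ with B ≟ᶠ B′
  ... | yes B≡B′ = B≡B′
  ... | no  B≢B′ = contradiction (same-label-disjoint same B≢B′) (count≢0 _ x (cong₂ _∧_ x∈B x∈B′))

  count-blocks-through : ∀ x {c} → 1 ≤ c → c ≤ κ → count (λ B → (label B ≡ᵇ c) ∧ inc x B) ≡ 1
  count-blocks-through x 1≤c c≤κ with block-through x 1≤c c≤κ
  ... | B , B-labelled , x∈B = count-unique _ B (cong₂ _∧_ (≡⇒≡ᵇ-true B-labelled) x∈B) unique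
    where
    unique : ∀ B′ → ((label B′ ≡ᵇ _) ∧ inc x B′) ≡ true → B′ ≡ B
    unique B′ B′-through = block-through-unique (trans (≡ᵇ-true⇒≡ (∧-conicalˡ _ _ B′-through)) (sym B-labelled))
                                                (∧-conicalʳ _ _ B′-through) x∈B

  class-size : ∀ {c} → 1 ≤ c → c ≤ κ → count (λ B → label B ≡ᵇ c) ≡ q
  class-size 1≤c c≤κ with some-block-labelled _ 1≤c c≤κ
  ... | B₀ , refl = trans (count-cong same-class-as-B₀) (classSize B₀)
    where
    same-class-as-B₀ : ∀ B → (label B ≡ᵇ label B₀) ≡ inClassOf B₀ B
    same-class-as-B₀ B = ⇔→≡ (mk⇔ (same-label⇒same-class B₀ B ∘ sym ∘ ≡ᵇ-true⇒≡)
                                  (≡⇒≡ᵇ-true ∘ sym ∘ same-class⇒same-label B₀ B))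

  npts≡q*blockSize : 1 ≤ κ → npts ≡ q * blockSize
  npts≡q*blockSize 1≤κ = begin
    npts                                         ≡⟨ count-const-true npts ⟨
    count {npts} (λ _ → true)                    ≡⟨ *-identityʳ _ ⟨
    count {npts} (λ _ → true) * 1                ≡⟨ double-count (λ _ → true) (λ B → label B ≡ᵇ 1) (λ x B → inc x B)
                                                      (λ x _ → count-blocks-through x ≤-refl 1≤κ) (λ B _ → isBlockReg B) ⟩
    count (λ B → label B ≡ᵇ 1) * blockSize       ≡⟨ cong (_* blockSize) (class-size ≤-refl 1≤κ) ⟩
    q * blockSize                                ∎

  blockSize≡q*r : 2 ≤ κ → blockSize ≡ q * r
  blockSize≡q*r 2≤κ with some-block-labelled 1 ≤-refl (≤-trans (s≤s z≤n) 2≤κ)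
  ... | B₀ , B₀-labelled = begin
    blockSize                                    ≡⟨ isBlockReg B₀ ⟨
    count (λ x → inc x B₀)                       ≡⟨ *-identityʳ _ ⟨
    count (λ x → inc x B₀) * 1                   ≡⟨ double-count (λ x → inc x B₀) (λ B → label B ≡ᵇ 2) (λ x B → inc x B)
                                                      (λ x _ → count-blocks-through x (s≤s z≤n) 2≤κ) meets-B₀ ⟩
    count (λ B → label B ≡ᵇ 2) * r               ≡⟨ cong (_* r) (class-size (s≤s z≤n) 2≤κ) ⟩
    q * r                                        ∎
    where
    meets-B₀ : ∀ B → (label B ≡ᵇ 2) ≡ true → meet B₀ B ≡ r
    meets-B₀ B B-labelled = different-labels-meet (λ same → 1≢2 (trans (sym B₀-labelled) (trans same (≡ᵇ-true⇒≡ B-labelled))))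
      where
      1≢2 : 1 ≢ 2
      1≢2 ()

  replication : ∀ x → count (λ B → inc x B) ≡ κ
  replication x = begin
    count (λ B → inc x B)                        ≡⟨ *-identityʳ _ ⟨
    count (λ B → inc x B) * 1                    ≡⟨ double-count (λ B → inc x B) (λ (_ : Fin κ) → true) (λ B c → label B ≡ᵇ suc (toℕ c))
                                                      (λ B _ → label-unique B) block-of-class ⟩
    count {κ} (λ _ → true) * 1                   ≡⟨ *-identityʳ _ ⟩
    count {κ} (λ _ → true)                       ≡⟨ count-const-true κ ⟩
    κ                                            ∎
    where
    label-unique : ∀ B → count (λ (c : Fin κ) → label B ≡ᵇ suc (toℕ c)) ≡ 1
    label-unique B with label B | labelled B
    ... | suc l | _ , l<κ = count-unique _ (fromℕ< l<κ) (≡⇒≡ᵇ-true (cong suc (sym (toℕ-fromℕ< l<κ))))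
                              (λ c l≡c → toℕ-injective (trans (sym (suc-injective (≡ᵇ-true⇒≡ l≡c))) (sym (toℕ-fromℕ< l<κ))))
    block-of-class : ∀ (c : Fin κ) → true ≡ true → count (λ B → inc x B ∧ (label B ≡ᵇ suc (toℕ c))) ≡ 1
    block-of-class c _ = trans (count-cong (λ B → ∧-comm (inc x B) _)) (count-blocks-through x (s≤s z≤n) (toℕ<n c))

-- Arithmetic. Here q = suc p, r = q^{d−2}, k = q r = q^{d−1}, N = q k = q^d, and μ is the pair
-- index of the affine designs; κ * p ≡ N ∸ 1 says κ = (q^d − 1)/(q − 1).

2≤κ : ∀ {κ p k} → κ * p ≡ suc p * k ∸ 1 → 2 ≤ k → 2 ≤ κ
2≤κ {κ} {p} {k} hκ 2≤k with 2 ≤? κ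
... | yes κ≥2 = κ≥2
... | no  2≰κ = contradiction (subst (p <_) (sym hκ) p<N-1) (≤⇒≯ κp≤p)
  where
  κp≤p : κ * p ≤ p
  κp≤p = ≤-trans (*-monoˡ-≤ p (≤-pred (≰⇒> 2≰κ))) (≤-reflexive (+-identityʳ p))
  p<N-1 : p < suc p * k ∸ 1
  p<N-1 = <-≤-trans (s≤s (m≤m*n p 2)) (∸-monoˡ-≤ 1 (*-monoʳ-≤ (suc p) 2≤k))

suc[p*μ]≡k : ∀ {κ p k μ} .{{_ : NonZero κ}} → κ * p ≡ suc p * k ∸ 1 →
             (suc p * k ∸ 1) * μ ≡ κ * (k ∸ 1) → 1 ≤ k → suc (p * μ) ≡ k
suc[p*μ]≡k {κ} {p} {suc k′} {μ} hκ fisher _ = cong suc (*-cancelˡ-≡ (p * μ) k′ κ (begin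
  κ * (p * μ)               ≡⟨ *-assoc κ p μ ⟨
  κ * p * μ                 ≡⟨ cong (_* μ) hκ ⟩
  (suc p * suc k′ ∸ 1) * μ  ≡⟨ fisher ⟩
  κ * k′                    ∎))

κ≡k+μ : ∀ {κ p k μ} .{{_ : NonZero p}} → κ * p ≡ suc p * k ∸ 1 → suc (p * μ) ≡ k → κ ≡ k + μ
κ≡k+μ {κ} {p} {μ = μ} hκ refl = *-cancelʳ-≡ κ (k + μ) p (begin
  κ * p              ≡⟨ hκ ⟩
  p * μ + p * k      ≡⟨ +-comm (p * μ) (p * k) ⟩
  p * k + p * μ      ≡⟨ *-distribˡ-+ p k μ ⟨
  p * (k + μ)        ≡⟨ *-comm p (k + μ) ⟩
  (k + μ) * p        ∎)
  where
  k : ℕ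
  k = suc (p * μ)

degree-arith : ∀ {κ p k} → κ * p ≡ suc p * k ∸ 1 → κ * (suc p * k ∸ k) ≡ k * (suc p * k ∸ 1)
degree-arith {κ} {p} {k} hκ = begin
  κ * (suc p * k ∸ k)    ≡⟨ cong (κ *_) (m+n∸m≡n k (p * k)) ⟩
  κ * (p * k)            ≡⟨ *-assoc κ p k ⟨
  κ * p * k              ≡⟨ *-comm (κ * p) k ⟩
  k * (κ * p)            ≡⟨ cong (k *_) hκ ⟩
  k * (suc p * k ∸ 1)    ∎

λ₁-arith : ∀ {p k μ L} .{{_ : NonZero p}} → suc (p * μ) ≡ k →
           L + (k + μ) * (k + k) ≡ (k + μ) * (suc p * k) + k * μ → L ≡ k * (suc p * k ∸ k ∸ 1)
λ₁-arith {suc p′} {k} {μ} {L} refl counted rewrite m+n∸m≡n k (suc p′ * k) =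
  +-cancelʳ-≡ ((k + μ) * (k + k)) L _ (trans counted (identity p′ k μ))
  where
  identity : ∀ p′ k μ → (k + μ) * (suc (suc p′) * k) + k * μ ≡ k * (suc p′ * μ + p′ * k) + (k + μ) * (k + k)
  identity = solve-∀

λ₂-arith : ∀ {p r c} → c + (suc p * r + suc p * r) ≡ suc p * (suc p * r) + r → c ≡ r * (p * p)
λ₂-arith {p} {r} {c} counted = +-cancelʳ-≡ (suc p * r + suc p * r) c _ (trans counted (sym (identity p r)))
  where
  identity : ∀ p r → r * (p * p) + (suc p * r + suc p * r) ≡ suc p * (suc p * r) + r
  identity = solve-∀

module GluedGraph
  {p b m κ lam : ℕ} {{_ : NonZero p}}
  (hκ : κ * p ≡ suc p ^ suc (suc b) ∸ 1)
  {A : Fin m → Fin m → Bool} (design : IsSymmetricDesign m κ lam A) (A-symmetric : IsSymmetricMatrix A)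
  {e : Fin m → Fin m → ℕ} (labelling : IsLabelling κ A e)
  {D : Fin m → AffineDesign (suc p) (suc p ^ b)}
  {label : (i : Fin m) → Fin (AffineDesign.nblocks (D i)) → ℕ}
  (classes : ∀ i → IsClassEnumeration κ (D i) (label i))
  {σ : (i j : Fin m) → Fin (AffineDesign.nblocks (D i)) → Fin (AffineDesign.nblocks (D j))}
  (gluing : Construction.IsGluing e D label σ)
  where

  open Construction e D label σ
  open AffineDesign

  q r k N : ℕ
  q = suc p
  r = q ^ b
  k = q * r
  N = q * k

  P : Fin m → ℕ
  P i = npts (D i)

  e≡0⇒A-false : ∀ {i j} → e i j ≡ 0 → A i j ≡ false
  e≡0⇒A-false {i} {j} = proj₁ (proj₁ labelling i j)

  A-false⇒e≡0 : ∀ {i j} → A i j ≡ false → e i j ≡ 0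
  A-false⇒e≡0 {i} {j} = proj₂ (proj₁ labelling i j)

  e≢0 : ∀ {i j} → A i j ≡ true → e i j ≢ 0
  e≢0 aij eij≡0 = contradiction (trans (sym aij) (e≡0⇒A-false eij≡0)) λ ()

  e-bounds : ∀ {i j} → A i j ≡ true → 1 ≤ e i j × e i j ≤ κ
  e-bounds {i} {j} = proj₁ (proj₂ labelling) i j

  e-injective : ∀ {i j j′} → A i j ≡ true → A i j′ ≡ true → e i j ≡ e i j′ → j ≡ j′
  e-injective {i} {j} {j′} = proj₁ (proj₂ (proj₂ labelling)) i j j′

  e-onto : ∀ i {c} → 1 ≤ c → c ≤ κ → ∃[ j ] (A i j ≡ true × e i j ≡ c)
  e-onto i {c} = proj₂ (proj₂ (proj₂ labelling)) i c

  σ-class : ∀ {i j} → e i j ≢ 0 → ∀ {B} → label i B ≡ e i j → label j (σ i j B) ≡ e j i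
  σ-class {i} {j} eij≢0 {B} = proj₁ gluing i j eij≢0 B

  σ-injective : ∀ {i j} → e i j ≢ 0 → ∀ {B B′} → label i B ≡ e i j → label i B′ ≡ e i j →
                σ i j B ≡ σ i j B′ → B ≡ B′
  σ-injective {i} {j} eij≢0 {B} {B′} = proj₁ (proj₂ gluing) i j eij≢0 B B′

  σ-inverse : ∀ {i j} → e i j ≢ 0 → i ≢ j → ∀ {B} → label i B ≡ e i j → σ j i (σ i j B) ≡ B
  σ-inverse {i} {j} eij≢0 i≢j {B} = proj₁ (proj₂ (proj₂ (proj₂ gluing))) i j eij≢0 i≢j B

  σ-diagonal : ∀ {i} → e i i ≢ 0 → ∀ {B} → label i B ≡ e i i → σ i i B ≡ B
  σ-diagonal {i} eii≢0 {B} = proj₂ (proj₂ (proj₂ (proj₂ gluing))) i eii≢0 B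

  row-size : ∀ i → count (A i) ≡ κ
  row-size i = trans (count-cong (A-symmetric i)) (proj₁ design i)

  module Dᵢ (i : Fin m) = ParallelClasses (D i) (classes i)

  2≤k : 2 ≤ k
  2≤k = *-mono-≤ (s≤s (>-nonZero⁻¹ p)) (m^n>0 q b)

  instance
    κ-nonZero : NonZero κ
    κ-nonZero = >-nonZero (≤-trans (s≤s z≤n) (2≤κ hκ 2≤k))

  blockSize≡k : ∀ i → blockSize (D i) ≡ k
  blockSize≡k i = Dᵢ.blockSize≡q*r i (2≤κ hκ 2≤k)

  npts≡N : ∀ i → npts (D i) ≡ N
  npts≡N i = trans (Dᵢ.npts≡q*blockSize i (>-nonZero⁻¹ κ)) (cong (q *_) (blockSize≡k i))

  suc[p*pairIndex]≡k : ∀ i → suc (p * pairIndex (D i)) ≡ k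
  suc[p*pairIndex]≡k i = suc[p*μ]≡k hκ fisher (≤-trans (s≤s z≤n) 2≤k)
    where
    x₀ : Fin (npts (D i))
    x₀ = subst Fin (sym (npts≡N i)) (fromℕ< (m^n>0 q (suc (suc b))))
    fisher : (N ∸ 1) * pairIndex (D i) ≡ κ * (k ∸ 1)
    fisher = begin
      (N ∸ 1) * pairIndex (D i)                                  ≡⟨ cong (λ n → (n ∸ 1) * pairIndex (D i)) (npts≡N i) ⟨
      (npts (D i) ∸ 1) * pairIndex (D i)                         ≡⟨ pairIndex-replication (D i) x₀ ⟩
      count (λ B → inc (D i) x₀ B) * (blockSize (D i) ∸ 1)       ≡⟨ cong₂ (λ c s → c * (s ∸ 1)) (Dᵢ.replication i x₀) (blockSize≡k i) ⟩
      κ * (k ∸ 1)                                                ∎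

  κ≡k+pairIndex : ∀ i → κ ≡ k + pairIndex (D i)
  κ≡k+pairIndex i = κ≡k+μ hκ (suc[p*pairIndex]≡k i)

  module _ {i h} (aih : A i h ≡ true) (x : Fin (npts (D i))) where

    private
      through : Σ[ B ∈ Fin (nblocks (D i)) ] label i B ≡ e i h × inc (D i) x B ≡ true
      through = Dᵢ.block-through i x (proj₁ (e-bounds aih)) (proj₂ (e-bounds aih))

    block : Fin (nblocks (D i))
    block = proj₁ through

    block-label : label i block ≡ e i h
    block-label = proj₁ (proj₂ through)

    ∈-block : inc (D i) x block ≡ true
    ∈-block = proj₂ (proj₂ through)

    image : Fin (nblocks (D h))
    image = σ i h block

    image-label : label h image ≡ e h i
    image-label = σ-class (e≢0 aih) block-label

  block-unique : ∀ {i h} (aih : A i h ≡ true) {x B} → label i B ≡ e i h → inc (D i) x B ≡ true → B ≡ block aih x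
  block-unique {i} aih {x} labelled x∈B = Dᵢ.block-through-unique i (trans labelled (sym (block-label aih x))) x∈B (∈-block aih x)

  inImage-image : ∀ {i h} (aih : A i h ≡ true) x z → inImage i h x z ≡ inc (D h) z (image aih x)
  inImage-image {i} {h} aih x z = trans (anyFin-unique _ (block aih x) elsewhere) at-block
    where
    elsewhere : ∀ B → B ≢ block aih x → ((label i B ≡ᵇ e i h) ∧ inc (D i) x B ∧ inc (D h) z (σ i h B)) ≡ false
    elsewhere B B≢ with label i B ≡ᵇ e i h in labelled | inc (D i) x B in x∈B
    ... | true  | true  = contradiction (block-unique aih (≡ᵇ-true⇒≡ labelled) x∈B) B≢
    ... | true  | false = refl
    ... | false | _     = refl
    at-block : ((label i (block aih x) ≡ᵇ e i h) ∧ inc (D i) x (block aih x) ∧ inc (D h) z (image aih x))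
               ≡ inc (D h) z (image aih x)
    at-block rewrite ≡⇒≡ᵇ-true (block-label aih x) | ∈-block aih x = refl

  adj-image : ∀ {i h} (aih : A i h ≡ true) x z → adj (i , x) (h , z) ≡ not (inc (D h) z (image aih x))
  adj-image {i} {h} aih x z rewrite ≢⇒≡ᵇ-false (e≢0 aih) with (i , x) ≟ᵥ (h , z)
  ... | yes refl = cong not (sym (trans (cong (inc (D i) x) (σ-diagonal (e≢0 aih) (block-label aih x))) (∈-block aih x)))
  ... | no _     = cong not (inImage-image aih x z)

  adj-non-incident : ∀ {i h} → A i h ≡ false → ∀ x z → adj (i , x) (h , z) ≡ false
  adj-non-incident {i} {h} aih x z rewrite A-false⇒e≡0 aih = ∧-zeroʳ _

  adj-irreflexive : ∀ u → adj u u ≡ false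
  adj-irreflexive u rewrite dec-true (u ≟ᵥ u) refl = refl

  image-back : ∀ {i h} (aih : A i h ≡ true) x → σ h i (image aih x) ≡ block aih x
  image-back {i} {h} aih x with i ≟ᶠ h
  ... | yes refl = trans (cong (σ i i) diagonal) diagonal
    where
    diagonal : σ i i (block aih x) ≡ block aih x
    diagonal = σ-diagonal (e≢0 aih) (block-label aih x)
  ... | no i≢h = σ-inverse (e≢0 aih) i≢h (block-label aih x)

  ∈-image-sym : ∀ {i j} (aij : A i j ≡ true) (aji : A j i ≡ true) x y →
                inc (D j) y (image aij x) ≡ true → inc (D i) x (image aji y) ≡ true
  ∈-image-sym {i} {j} aij aji x y y∈image = begin
    inc (D i) x (σ j i (block aji y))  ≡⟨ cong (inc (D i) x ∘ σ j i) (block-unique aji (image-label aij x) y∈image) ⟨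
    inc (D i) x (σ j i (image aij x))  ≡⟨ cong (inc (D i) x) (image-back aij x) ⟩
    inc (D i) x (block aij x)          ≡⟨ ∈-block aij x ⟩
    true                               ∎

  adj-symmetric : ∀ u w → adj u w ≡ adj w u
  adj-symmetric (i , x) (j , y) with A i j in aij
  ... | false = trans (adj-non-incident aij x y) (sym (adj-non-incident (trans (A-symmetric j i) aij) y x))
  ... | true  = begin
    adj (i , x) (j , y)                  ≡⟨ adj-image aij x y ⟩
    not (inc (D j) y (image aij x))      ≡⟨ cong not (⇔→≡ (mk⇔ (∈-image-sym aij aji x y) (∈-image-sym aji aij y x))) ⟩
    not (inc (D i) x (image aji y))      ≡⟨ adj-image aji y x ⟨
    adj (j , y) (i , x)                  ∎
    where
    aji : A j i ≡ true
    aji = trans (A-symmetric j i) aij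

  complement-size : ∀ h B → count (λ z → not (inc (D h) z B)) ≡ N ∸ k
  complement-size h B = begin
    count (not ∘ inB)
      ≡⟨ m+n∸n≡m _ (count inB) ⟨
    count (not ∘ inB) + count inB ∸ count inB
      ≡⟨ cong₂ _∸_ (trans (count-not inB) (npts≡N h)) (trans (isBlockReg (D h) B) (blockSize≡k h)) ⟩
    N ∸ k ∎
    where
    inB : Fin (npts (D h)) → Bool
    inB z = inc (D h) z B

  slice-degree : ∀ {i} x h → count (λ z → adj (i , x) (h , z)) ≡ (if A i h then N ∸ k else 0)
  slice-degree {i} x h with A i h in aih
  ... | true  = trans (count-cong (adj-image aih x)) (complement-size h (image aih x))
  ... | false = count-none _ (adj-non-incident aih x)

  common-slice : ∀ {i j h} (aih : A i h ≡ true) (ajh : A j h ≡ true) x y →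
                 count (λ z → adj (i , x) (h , z) ∧ adj (j , y) (h , z)) + (k + k) ≡ N + meet (D h) (image aih x) (image ajh y)
  common-slice {i} {j} {h} aih ajh x y = begin
    count (λ z → adj (i , x) (h , z) ∧ adj (j , y) (h , z)) + (k + k)
      ≡⟨ cong₂ _+_ (count-cong (λ z → cong₂ _∧_ (adj-image aih x z) (adj-image ajh y z))) (sym (cong₂ _+_ (size Sx) (size Sy))) ⟩
    count (λ z → not (inSx z) ∧ not (inSy z)) + (count inSx + count inSy)
      ≡⟨ +-assoc _ (count inSx) (count inSy) ⟨
    count (λ z → not (inSx z) ∧ not (inSy z)) + count inSx + count inSy
      ≡⟨ count-neither inSx inSy ⟩
    npts (D h) + meet (D h) Sx Sy
      ≡⟨ cong (_+ meet (D h) Sx Sy) (npts≡N h) ⟩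
    N + meet (D h) Sx Sy ∎
    where
    Sx Sy : Fin (nblocks (D h))
    Sx = image aih x
    Sy = image ajh y
    inSx inSy : Fin (npts (D h)) → Bool
    inSx z = inc (D h) z Sx
    inSy z = inc (D h) z Sy
    size : ∀ S → count (λ z → inc (D h) z S) ≡ k
    size S = trans (isBlockReg (D h) S) (blockSize≡k h)

  images-meet-across : ∀ {i j h} (aih : A i h ≡ true) (ajh : A j h ≡ true) x y → i ≢ j →
                       meet (D h) (image aih x) (image ajh y) ≡ r
  images-meet-across {i} {j} {h} aih ajh x y i≢j = Dᵢ.different-labels-meet h λ same →
    i≢j (e-injective (trans (A-symmetric h i) aih) (trans (A-symmetric h j) ajh)
                     (trans (sym (image-label aih x)) (trans same (image-label ajh y))))

  slice-λ₂ : ∀ {i j} → i ≢ j → ∀ x y h →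
             count (λ z → adj (i , x) (h , z) ∧ adj (j , y) (h , z)) ≡ (if A i h ∧ A j h then r * (p * p) else 0)
  slice-λ₂ {i} {j} i≢j x y h with A i h in aih | A j h in ajh
  ... | false | _     = count-none _ (λ z → cong (_∧ adj (j , y) (h , z)) (adj-non-incident aih x z))
  ... | true  | false =
    count-none _ (λ z → trans (cong (adj (i , x) (h , z) ∧_) (adj-non-incident ajh y z)) (∧-zeroʳ _))
  ... | true  | true  =
    λ₂-arith {p} {r} (trans (common-slice aih ajh x y) (cong (N +_) (images-meet-across aih ajh x y i≢j)))

  images-meet-within : ∀ {i h} (aih : A i h ≡ true) x y →
                       meet (D h) (image aih x) (image aih y)
                       ≡ k * count (λ B → (inc (D i) x B ∧ inc (D i) y B) ∧ (label i B ≡ᵇ e i h))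
  images-meet-within {i} {h} aih x y with inc (D i) y (block aih x) in y∈Bx
  ... | true = begin
    meet (D h) (image aih x) (image aih y)
      ≡⟨ cong (λ B → meet (D h) (image aih x) (σ i h B)) (block-unique aih (block-label aih x) y∈Bx) ⟨
    meet (D h) (image aih x) (image aih x)
      ≡⟨ count-cong (λ z → ∧-idem (inc (D h) z (image aih x))) ⟩
    count (λ z → inc (D h) z (image aih x))
      ≡⟨ trans (isBlockReg (D h) _) (blockSize≡k h) ⟩
    k
      ≡⟨ *-identityʳ k ⟨
    k * 1
      ≡⟨ cong (k *_) (count-unique _ (block aih x) Bx-through-x-y through-x-y) ⟨
    k * count (λ B → (inc (D i) x B ∧ inc (D i) y B) ∧ (label i B ≡ᵇ e i h)) ∎
    where
    Bx-through-x-y : ((inc (D i) x (block aih x) ∧ inc (D i) y (block aih x)) ∧ (label i (block aih x) ≡ᵇ e i h)) ≡ true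
    Bx-through-x-y = cong₂ _∧_ (cong₂ _∧_ (∈-block aih x) y∈Bx) (≡⇒≡ᵇ-true (block-label aih x))
    through-x-y : ∀ B → ((inc (D i) x B ∧ inc (D i) y B) ∧ (label i B ≡ᵇ e i h)) ≡ true → B ≡ block aih x
    through-x-y B t = block-unique aih (≡ᵇ-true⇒≡ (∧-conicalʳ _ _ t)) (∧-conicalˡ _ _ (∧-conicalˡ _ _ t))
  ... | false = begin
    meet (D h) (image aih x) (image aih y)
      ≡⟨ Dᵢ.same-label-disjoint h (trans (image-label aih x) (sym (image-label aih y))) images-differ ⟩
    0
      ≡⟨ *-zeroʳ k ⟨
    k * 0
      ≡⟨ cong (k *_) (count-none _ no-common-block) ⟨
    k * count (λ B → (inc (D i) x B ∧ inc (D i) y B) ∧ (label i B ≡ᵇ e i h)) ∎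
    where
    y∉Bx : ∀ {B} → B ≡ block aih x → inc (D i) y B ≢ true
    y∉Bx refl y∈B = contradiction (trans (sym y∈B) y∈Bx) λ ()
    images-differ : image aih x ≢ image aih y
    images-differ same = y∉Bx (σ-injective (e≢0 aih) (block-label aih y) (block-label aih x) (sym same)) (∈-block aih y)
    no-common-block : ∀ B → ((inc (D i) x B ∧ inc (D i) y B) ∧ (label i B ≡ᵇ e i h)) ≡ false
    no-common-block B with inc (D i) x B in x∈B | inc (D i) y B in y∈B | label i B ≡ᵇ e i h in labelled
    ... | true  | true  | true  = contradiction y∈B (y∉Bx (block-unique aih (≡ᵇ-true⇒≡ labelled) x∈B))
    ... | true  | true  | false = refl
    ... | true  | false | _     = refl
    ... | false | _     | _     = refl

  slice-λ₁ : ∀ {i} x y h →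
             count (λ z → adj (i , x) (h , z) ∧ adj (i , y) (h , z)) + (if A i h then k + k else 0)
             ≡ (if A i h then N else 0)
               + k * count (λ B → (inc (D i) x B ∧ inc (D i) y B) ∧ (A i h ∧ (label i B ≡ᵇ e i h)))
  slice-λ₁ {i} x y h with A i h in aih
  ... | true  = trans (common-slice aih aih x y) (cong (N +_) (images-meet-within aih x y))
  ... | false = begin
    count (λ z → adj (i , x) (h , z) ∧ adj (i , y) (h , z)) + 0
      ≡⟨ +-identityʳ _ ⟩
    count (λ z → adj (i , x) (h , z) ∧ adj (i , y) (h , z))
      ≡⟨ count-none _ (λ z → cong (_∧ adj (i , y) (h , z)) (adj-non-incident aih x z)) ⟩
    0
      ≡⟨ *-zeroʳ k ⟨
    k * 0
      ≡⟨ cong (k *_) (count-none (λ B → (inc (D i) x B ∧ inc (D i) y B) ∧ false) (λ B → ∧-zeroʳ _)) ⟨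
    k * count (λ B → (inc (D i) x B ∧ inc (D i) y B) ∧ false) ∎

  row-label-unique : ∀ i B → count (λ h → A i h ∧ (label i B ≡ᵇ e i h)) ≡ 1
  row-label-unique i B with e-onto i (proj₁ (Dᵢ.labelled i B)) (proj₂ (Dᵢ.labelled i B))
  ... | h₀ , aih₀ , eih₀≡label = count-unique _ h₀ (cong₂ _∧_ aih₀ (≡⇒≡ᵇ-true (sym eih₀≡label))) at-h₀
    where
    at-h₀ : ∀ h → (A i h ∧ (label i B ≡ᵇ e i h)) ≡ true → h ≡ h₀
    at-h₀ h t = e-injective (∧-conicalˡ _ _ t) aih₀ (trans (sym (≡ᵇ-true⇒≡ (∧-conicalʳ _ _ t))) (sym eih₀≡label))

  pairIndex-as-sum : ∀ {i} x y → x ≢ y →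
    ∑[ h < m ] count (λ B → (inc (D i) x B ∧ inc (D i) y B) ∧ (A i h ∧ (label i B ≡ᵇ e i h))) ≡ pairIndex (D i)
  pairIndex-as-sum {i} x y x≢y = begin
    ∑[ h < m ] count (λ B → xy B ∧ (A i h ∧ (label i B ≡ᵇ e i h)))
      ≡⟨ count-swap (λ h B → xy B ∧ (A i h ∧ (label i B ≡ᵇ e i h))) ⟩
    ∑[ B < nblocks (D i) ] count (λ h → xy B ∧ (A i h ∧ (label i B ≡ᵇ e i h)))
      ≡⟨ ∑-count-guarded xy (λ B h → A i h ∧ (label i B ≡ᵇ e i h)) (λ B _ → row-label-unique i B) ⟩
    count xy * 1                                  ≡⟨ *-identityʳ _ ⟩
    count xy                                      ≡⟨ is2design (D i) x y x≢y ⟩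
    pairIndex (D i)                               ∎
    where
    xy : Fin (nblocks (D i)) → Bool
    xy B = inc (D i) x B ∧ inc (D i) y B

  module _ {xs : List Vertex} (enum : IsEnumeration xs) where

    vertex-count : length xs ≡ N * m
    vertex-count = begin
      length xs                          ≡⟨ length≡countL xs ⟩
      countL xs (λ _ → true)             ≡⟨ countL-enumeration P enum (λ _ → true) ⟩
      ∑[ i < m ] count {P i} (λ _ → true) ≡⟨ sum-cong-≗ (λ i → trans (count-const-true (P i)) (npts≡N i)) ⟩
      ∑[ i < m ] N                       ≡⟨ ∑-const m N ⟩
      m * N                              ≡⟨ *-comm m N ⟩
      N * m                              ∎

    class-count : ∀ c → countL xs (λ u → does (proj₁ u ≟ᶠ c)) ≡ N
    class-count c = begin
      countL xs (λ u → does (proj₁ u ≟ᶠ c))            ≡⟨ countL-enumeration P enum _ ⟩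
      ∑[ i < m ] count {P i} (λ _ → does (i ≟ᶠ c))      ≡⟨ ∑-single _ c other-class ⟩
      count {P c} (λ _ → does (c ≟ᶠ c))                 ≡⟨ count-cong {P c} (λ _ → dec-true (c ≟ᶠ c) refl) ⟩
      count {P c} (λ _ → true)                          ≡⟨ count-const-true (P c) ⟩
      P c                                               ≡⟨ npts≡N c ⟩
      N                                                 ∎
      where
      other-class : ∀ i → i ≢ c → count {P i} (λ _ → does (i ≟ᶠ c)) ≡ 0
      other-class i i≢c = count-none {P i} _ (λ _ → dec-false (i ≟ᶠ c) i≢c)

    degree : ∀ u → countL xs (adj u) ≡ k * (N ∸ 1)
    degree (i , x) = begin
      countL xs (adj (i , x))                    ≡⟨ countL-enumeration P enum (adj (i , x)) ⟩
      ∑[ h < m ] count (λ z → adj (i , x) (h , z)) ≡⟨ ∑-guarded (A i) _ (N ∸ k) (slice-degree x) ⟩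
      count (A i) * (N ∸ k)                      ≡⟨ cong (_* (N ∸ k)) (row-size i) ⟩
      κ * (N ∸ k)                                ≡⟨ degree-arith {κ} {p} {k} hκ ⟩
      k * (N ∸ 1)                                ∎

    λ₂ : ∀ u w → proj₁ u ≢ proj₁ w → commonNbrs xs adj u w ≡ r * (p * p) * lam
    λ₂ (i , x) (j , y) i≢j = begin
      commonNbrs xs adj (i , x) (j , y)
        ≡⟨ countL-enumeration P enum _ ⟩
      ∑[ h < m ] count (λ z → adj (i , x) (h , z) ∧ adj (j , y) (h , z))
        ≡⟨ ∑-guarded (λ h → A i h ∧ A j h) _ _ (slice-λ₂ i≢j x y) ⟩
      count (λ h → A i h ∧ A j h) * (r * (p * p))
        ≡⟨ cong (_* (r * (p * p))) (proj₂ design i j i≢j) ⟩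
      lam * (r * (p * p))
        ≡⟨ *-comm lam _ ⟩
      r * (p * p) * lam ∎

    λ₁ : ∀ u w → u ≢ w → proj₁ u ≡ proj₁ w → commonNbrs xs adj u w ≡ k * (N ∸ k ∸ 1)
    λ₁ (i , x) (.i , y) u≢w refl = λ₁-arith (suc[p*pairIndex]≡k i) (begin
      commonNbrs xs adj (i , x) (i , y) + (k + μ) * (k + k)
        ≡⟨ cong₂ _+_ (countL-enumeration P enum _) (cong (_* (k + k)) (sym (κ≡k+pairIndex i))) ⟩
      ∑[ h < m ] c h + κ * (k + k)
        ≡⟨ cong (∑[ h < m ] c h +_) (sym (trans (∑-guarded (A i) _ (k + k) (λ _ → refl)) (cong (_* (k + k)) (row-size i)))) ⟩
      ∑[ h < m ] c h + ∑[ h < m ] (if A i h then k + k else 0)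
        ≡⟨ ∑-distrib-+ c _ ⟨
      ∑[ h < m ] (c h + (if A i h then k + k else 0))
        ≡⟨ sum-cong-≗ (slice-λ₁ x y) ⟩
      ∑[ h < m ] ((if A i h then N else 0) + k * J h)
        ≡⟨ ∑-distrib-+ _ (λ h → k * J h) ⟩
      ∑[ h < m ] (if A i h then N else 0) + ∑[ h < m ] (k * J h)
        ≡⟨ cong₂ _+_ (∑-guarded (A i) _ N (λ _ → refl)) (sym (*-distribˡ-sum k J)) ⟩
      count (A i) * N + k * ∑[ h < m ] J h
        ≡⟨ cong₂ _+_ (cong (_* N) (trans (row-size i) (κ≡k+pairIndex i)))
                     (cong (k *_) (pairIndex-as-sum x y (u≢w ∘ cong (i ,_)))) ⟩
      (k + μ) * N + k * μ ∎)
      where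
      μ : ℕ
      μ = pairIndex (D i)
      c J : Fin m → ℕ
      c h = count (λ z → adj (i , x) (h , z) ∧ adj (i , y) (h , z))
      J h = count (λ B → (inc (D i) x B ∧ inc (D i) y B) ∧ (A i h ∧ (label i B ≡ᵇ e i h)))

  isDDG : IsDDG Vertex adj (N * m) (k * (N ∸ 1)) (k * (N ∸ k ∸ 1)) (r * (p * p) * lam) m N
  isDDG = (canonicalEnumeration m P , canonicalEnumeration-isEnumeration m P) , (adj-symmetric , adj-irreflexive) ,
          λ xs enum → vertex-count enum , degree enum , proj₁ , class-count enum , λ₁ enum , λ₂ enum

theorem1 : (q d m κ lam : ℕ) → 2 ≤ q → 2 ≤ d
    → κ * (q ∸ 1) ≡ q ^ d ∸ 1
    → (A : Fin m → Fin m → Bool)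
    → IsSymmetricDesign m κ lam A → IsSymmetricMatrix A
    → (e : Fin m → Fin m → ℕ)
    → IsSymmetricMatrix e → IsLabelling κ A e
    → (D : Fin m → AffineDesign q (q ^ (d ∸ 2)))
    → (label : (i : Fin m) → Fin (AffineDesign.nblocks (D i)) → ℕ)
    → (∀ i → IsClassEnumeration κ (D i) (label i))
    → (σ : (i j : Fin m) → Fin (AffineDesign.nblocks (D i)) → Fin (AffineDesign.nblocks (D j)))
    → Construction.IsGluing e D label σ
    → IsDDG (Construction.Vertex e D label σ) (Construction.adj e D label σ)
        (q ^ d * m)
        (q ^ (d ∸ 1) * (q ^ d ∸ 1))
        (q ^ (d ∸ 1) * (q ^ d ∸ q ^ (d ∸ 1) ∸ 1))
        (q ^ (d ∸ 2) * ((q ∸ 1) * (q ∸ 1)) * lam)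
        m
        (q ^ d)
theorem1 zero          _             _ _ _ ()
theorem1 (suc p)       zero          _ _ _ _        ()
theorem1 (suc p)       (suc zero)    _ _ _ _        (s≤s ())
-- With q = suc p and d = 2 + b, the terms q ∸ 1, q ^ (d ∸ 1) and q ^ (d ∸ 2) compute.
theorem1 (suc p)       (suc (suc b)) m κ lam (s≤s 1≤p) _ hκ A design A-symmetric e _ labelling D label classes σ gluing =
  GluedGraph.isDDG {b = b} {{>-nonZero 1≤p}} hκ design A-symmetric labelling {D = D} classes {σ = σ} gluing
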